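{- ${\sf CAC}$ and $\omega\text{ - }{\sf CAC}$ are equivalent under generalized Weihrauch reducibility: ${\sf CAC}\le_{\mathrm{gW}}\omega\text{ - }{\sf CAC}$ and $\omega\text{ - }{\sf CAC}\le_{\mathrm{gW}}{\sf CAC}$.
   Context: A poset $(P,\le_P)$ consists of $P\subseteq\omega$ and a reflexive, antisymmetric, transitive relation $\le_P$ on $P$; chains (antichains) are sets of pairwise comparable (incomparable) elements; it is $\omega$-ordered if $x\le_P y$ implies $x\le y$. A problem consists of a class of instances (subsets of $\omega$) and, for each instance, a class of solutions. ${\sf CAC}$ is the problem whose instances are infinite posets $(P,\le_P)$ with $P\subseteq\omega$ and whose solutions are infinite chains or infinite antichains of the instance; $\omega\text{ - }{\sf CAC}$ is ${\sf CAC}$ restricted to $\omega$-ordered instances. For problems $\mathsf P,\mathsf Q$, the reduction game $G(\mathsf Q\to\mathsf P)$ is played as follows: Player I first plays a $\mathsf P$-instance $X_0$; Player II either plays an $X_0$-computable solution to $X_0$ (and wins) or plays a $\mathsf Q$-instance $Y_1\le_T X_0$. At move $n>1$, Player I plays a solution $X_{n-1}$ to the $\mathsf Q$-instance $Y_{n-1}$, and Player II either plays a $\bigoplus_{i<n}X_i$-computable solution to $X_0$ (and wins) or a $\mathsf Q$-instance $Y_n\le_T\bigoplus_{i<n}X_i$. If Player II cannot respond, or never wins, Player I wins. $\mathsf P\le_{\mathrm{gW}}\mathsf Q$ means Player II has a winning computable strategy, i.e. a Turing functional which, given the join of Player I's first $n$ moves, outputs Player II's $n$th move (together with a flag saying whether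 it is a winning solution), and which wins against every play of Player I. -}

module Defs where

open import Data.Nat using (ℕ; zero; suc; _+_; _≤_; _<_; _<ᵇ_)
open import Data.Bool using (Bool; true; false; if_then_else_)
open import Data.Fin using (Fin)
open import Data.Vec using (Vec; []; _∷_; lookup)
open import Data.Maybe using (Maybe; just; nothing)
open import Data.Product using (Σ; _×_; _,_)
open import Data.Sum using (_⊎_)
open import Relation.Binary.PropositionalEquality using (_≡_)

SetN : Set
SetN = ℕ → Bool

tri : ℕ → ℕ
tri zero    = 0
tri (suc n) = tri n + suc n

pair : ℕ → ℕ → ℕ
pair x y = tri (x + y) + y

-- its inverse, by walking along the diagonals
-- (0,0),(1,0),(0,1),(2,0),(1,1),(0,2),...
nextPair : ℕ × ℕ → ℕ × ℕ
nextPair (zero  , y) = (suc y , 0)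
nextPair (suc x , y) = (x , suc y)

unpair : ℕ → ℕ × ℕ
unpair zero    = (0 , 0)
unpair (suc c) = nextPair (unpair c)

join : (ℕ → SetN) → ℕ → SetN
join X n c with unpair c
... | (i , k) = if i <ᵇ n then X i k else false

data Code : ℕ → Set where
  zeroC  : ∀ {n} → Code n
  succC  : Code 1
  proj   : ∀ {n} → Fin n → Code n
  oracle : Code 1
  comp   : ∀ {m n} → Code m → (Fin m → Code n) → Code n
  prec   : ∀ {n} → Code n → Code (suc (suc n)) → Code (suc n)
  mu     : ∀ {n} → Code (suc n) → Code n

bit : Bool → ℕ
bit true  = 1
bit false = 0

mutual
  -- fuel-bounded evaluation of a code relative to an oracle Z
  eval : ℕ → SetN → ∀ {n} → Code n → Vec ℕ n → Maybe ℕ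
  eval zero    Z c xs = nothing
  eval (suc f) Z zeroC xs = just 0
  eval (suc f) Z succC (x ∷ []) = just (suc x)
  eval (suc f) Z (proj i) xs = just (lookup xs i)
  eval (suc f) Z oracle (x ∷ []) = just (bit (Z x))
  eval (suc f) Z (comp h gs) xs with evalVec f Z gs xs
  ... | nothing = nothing
  ... | just ys = eval f Z h ys
  eval (suc f) Z (prec g h) (zero ∷ xs) = eval f Z g xs
  eval (suc f) Z (prec g h) (suc k ∷ xs) with eval f Z (prec g h) (k ∷ xs)
  ... | nothing = nothing
  ... | just r  = eval f Z h (k ∷ r ∷ xs)
  eval (suc f) Z (mu g) xs = search f Z g xs f 0

  evalVec : ℕ → SetN → ∀ {m n} → (Fin m → Code n) → Vec ℕ n → Maybe (Vec ℕ m)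
  evalVec f Z {zero}  gs xs = just []
  evalVec f Z {suc m} gs xs with eval f Z (gs Fin.zero) xs
  ... | nothing = nothing
  ... | just y with evalVec f Z (λ i → gs (Fin.suc i)) xs
  ...   | nothing = nothing
  ...   | just ys = just (y ∷ ys)

  search : ℕ → SetN → ∀ {n} → Code (suc n) → Vec ℕ n → ℕ → ℕ → Maybe ℕ
  search f Z g xs zero    k = nothing
  search f Z g xs (suc r) k with eval f Z g (k ∷ xs)
  ... | nothing      = nothing
  ... | just zero    = just k
  ... | just (suc _) = search f Z g xs r (suc k)

Conv : ∀ {n} → Code n → SetN → Vec ℕ n → ℕ → Set
Conv c Z xs v = Σ ℕ λ f → eval f Z c xs ≡ just v

record Problem : Set₁ where
  field
    Inst : SetN → Set
    Sol  : SetN → SetN → Set     -- Sol X Y : Y is a solution to the instance X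

-- A strategy for Player II is a Turing functional e : Code 2.
-- Let X 0, X 1, ... be Player I's moves.  Player II's n-th move (n ≥ 1)
-- is computed from the oracle ⨁_{i<n} X i on inputs (n , k):
--   input (n , 0)     : flag, 1 = "this is a solution to X 0 (I win)",
--                             0 = "this is a Q-instance"
--   input (n , suc k) : bit k of the played set (0 = false, >0 = true)

toBool : ℕ → Bool
toBool zero    = false
toBool (suc _) = true

module Game (P Q : Problem) (e : Code 2) (X : ℕ → SetN) where
  open Problem

  Flag : ℕ → ℕ → Set
  Flag n v = Conv e (join X n) (n ∷ 0 ∷ []) v

  Plays : ℕ → SetN → Set
  Plays n Y = ∀ k → Σ ℕ λ v → Conv e (join X n) (n ∷ suc k ∷ []) v × toBool v ≡ Y k

  Continues : ℕ → SetN → Set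
  Continues n Y = Flag n 0 × Plays n Y × Inst Q Y

  Legal : Set
  Legal = ∀ m → 1 ≤ m → (∀ j → 1 ≤ j → j < m → Flag j 0) →
          ∀ Y → Continues m Y → Sol Q Y (X m)

  Wins : Set
  Wins = Σ ℕ λ n → 1 ≤ n ×
           (∀ j → 1 ≤ j → j < n → Σ SetN λ Y → Continues j Y) ×
           Σ SetN λ S → Flag n 1 × Plays n S × Sol P (X 0) S

WinningStrategy : Problem → Problem → Code 2 → Set
WinningStrategy P Q e = ∀ (X : ℕ → SetN) → Problem.Inst P (X 0) →
  Game.Legal P Q e X → Game.Wins P Q e X

_≤gW_ : Problem → Problem → Set
P ≤gW Q = Σ (Code 2) λ e → WinningStrategy P Q e

Dom : SetN → ℕ → Set
Dom X x = X (pair 0 x) ≡ true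

Le : SetN → ℕ → ℕ → Set
Le X x y = X (pair 1 (pair x y)) ≡ true

NLe : SetN → ℕ → ℕ → Set
NLe X x y = X (pair 1 (pair x y)) ≡ false

InfiniteSet : SetN → Set
InfiniteSet S = ∀ n → Σ ℕ λ x → n ≤ x × S x ≡ true

IsPoset : SetN → Set
IsPoset X =
  (∀ x → Dom X x → Le X x x) ×
  (∀ x y → Dom X x → Dom X y → Le X x y → Le X y x → x ≡ y) ×
  (∀ x y z → Dom X x → Dom X y → Dom X z → Le X x y → Le X y z → Le X x z)

IsInfinitePoset : SetN → Set
IsInfinitePoset X = IsPoset X × InfiniteSet (λ x → X (pair 0 x))

OmegaOrdered : SetN → Set
OmegaOrdered X = ∀ x y → Dom X x → Dom X y → Le X x y → x ≤ y

SubsetDom : SetN → SetN → Set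
SubsetDom X S = ∀ x → S x ≡ true → Dom X x

IsChain : SetN → SetN → Set
IsChain X S = ∀ x y → S x ≡ true → S y ≡ true → Le X x y ⊎ Le X y x

IsAntichain : SetN → SetN → Set
IsAntichain X S = ∀ x y → S x ≡ true → S y ≡ true → (x ≡ y → Data.Empty.⊥) →
  NLe X x y × NLe X y x
  where import Data.Empty

CACSol : SetN → SetN → Set
CACSol X S = SubsetDom X S × InfiniteSet S × (IsChain X S ⊎ IsAntichain X S)

CAC : Problem
CAC = record { Inst = IsInfinitePoset ; Sol = CACSol }

ωCAC : Problem
ωCAC = record { Inst = λ X → IsInfinitePoset X × OmegaOrdered X ; Sol = CACSol }

-- ω-CAC reduces to CAC by forwarding the instance and copying back the solution.
-- For the converse, given a poset (P, ≤_P) Player II first asks for a solution A of the ω-ordered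
-- refinement x ≤₁ y ⇔ x ≤ y ∧ x ≤_P y. If A is a ≤₁-chain then ≤ and ≤_P agree on A; if A is a
-- ≤₁-antichain then ≤ and ≤_P are opposite on ≤_P-comparable pairs of A. Either way ≤_P-comparability
-- is transitive along ≤-increasing triples of A, so x ≤₂ y ⇔ x ≤ y ∧ (x and y are ≤_P-comparable)
-- is an ω-ordered poset on A. Its chains are ≤_P-chains and its antichains ≤_P-antichains, so a
-- solution of it solves P. Both strategies are primitive recursive in the oracle; written as
-- expressions, they compile to Turing functionals that converge on every input.

module Submission where

open import Defs
open import Data.Bool using (Bool; true; false; _∧_; _∨_)
open import Data.Bool.Properties using (T-≡; ¬-not)
open import Data.Empty using (⊥-elim)
open import Data.Fin using (Fin) renaming (zero to fz; suc to fs)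
open import Data.Maybe using (just)
open import Data.Nat
  using (ℕ; zero; suc; pred; _+_; _∸_; _⊔_; _≤_; _<_; _≤ᵇ_; _<ᵇ_; z≤n; s≤s; z<s; _≤′_; ≤′-refl; ≤′-step; _≟_)
open import Data.Nat.Properties
  using ( m≤m⊔n; m≤n⊔m; ≤⇒≤′; ≤-refl; ≤-antisym; ≤-trans; ≤-total; n<1+n; m≤n⇒m<n∨m≡n
        ; <⇒<ᵇ; ≤ᵇ⇒≤; ≤⇒≤ᵇ
        ; pred[m∸n]≡m∸[1+n]; +-suc; +-identityʳ; suc-injective; m+n∸m≡n; n∸n≡0; +-∸-assoc )
open import Data.Product as Product using (Σ; _×_; _,_; proj₁; proj₂)
open import Data.Sum as Sum using (_⊎_; inj₁; inj₂)
open import Data.Vec using (Vec; []; _∷_; lookup)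
open import Function using (_∘_; id)
open import Function.Bundles using (Equivalence)
open import Relation.Binary.PropositionalEquality
open import Relation.Nullary using (¬_; yes; no)

primRec : (ℕ → ℕ → ℕ) → ℕ → ℕ → ℕ
primRec s z zero    = z
primRec s z (suc k) = s k (primRec s z k)

mutual
  eval-mono-suc : ∀ {f Z n} (c : Code n) {xs v} → eval f Z c xs ≡ just v → eval (suc f) Z c xs ≡ just v
  eval-mono-suc {zero} c ()
  eval-mono-suc {suc f} zeroC e = e
  eval-mono-suc {suc f} succC {_ ∷ []} e = e
  eval-mono-suc {suc f} (proj i) e = e
  eval-mono-suc {suc f} oracle {_ ∷ []} e = e
  eval-mono-suc {suc f} {Z} (comp h gs) {xs} e with evalVec f Z gs xs in eq
  ... | just ys rewrite evalVec-mono-suc {f} {Z} gs {xs} eq = eval-mono-suc h e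
  eval-mono-suc {suc f} (prec g h) {zero ∷ xs} e = eval-mono-suc g e
  eval-mono-suc {suc f} {Z} (prec g h) {suc k ∷ xs} e with eval f Z (prec g h) (k ∷ xs) in eq
  ... | just r rewrite eval-mono-suc {f} {Z} (prec g h) {k ∷ xs} eq = eval-mono-suc h e
  eval-mono-suc {suc f} (mu g) e = search-mono-suc g f e

  evalVec-mono-suc : ∀ {f Z m n} (gs : Fin m → Code n) {xs ys} →
                     evalVec f Z gs xs ≡ just ys → evalVec (suc f) Z gs xs ≡ just ys
  evalVec-mono-suc {m = zero} gs e = e
  evalVec-mono-suc {f} {Z} {suc m} gs {xs} e with eval f Z (gs fz) xs in eq₁
  ... | just y with evalVec f Z (λ i → gs (fs i)) xs in eq₂
  ...   | just ys rewrite eval-mono-suc {f} {Z} (gs fz) {xs} eq₁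
                      | evalVec-mono-suc {f} {Z} (λ i → gs (fs i)) {xs} eq₂ = e

  search-mono-suc : ∀ {f Z n} (g : Code (suc n)) {xs} r {k v} →
                    search f Z g xs r k ≡ just v → search (suc f) Z g xs (suc r) k ≡ just v
  search-mono-suc {f} {Z} g {xs} (suc r) {k} e with eval f Z g (k ∷ xs) in eq
  ... | just zero    rewrite eval-mono-suc {f} {Z} g {k ∷ xs} eq = e
  ... | just (suc _) rewrite eval-mono-suc {f} {Z} g {k ∷ xs} eq = search-mono-suc g r e

eval-mono : ∀ {f f′ Z n} {c : Code n} {xs v} → f ≤ f′ → eval f Z c xs ≡ just v → eval f′ Z c xs ≡ just v
eval-mono {c = c} f≤f′ = go (≤⇒≤′ f≤f′)
  where
  go : ∀ {f f′ Z xs v} → f ≤′ f′ → eval f Z c xs ≡ just v → eval f′ Z c xs ≡ just v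
  go ≤′-refl       e = e
  go (≤′-step f≤f′) e = eval-mono-suc c (go f≤f′ e)

evalVec-mono : ∀ {f f′ Z m n} {gs : Fin m → Code n} {xs ys} → f ≤ f′ →
               evalVec f Z gs xs ≡ just ys → evalVec f′ Z gs xs ≡ just ys
evalVec-mono {gs = gs} f≤f′ = go (≤⇒≤′ f≤f′)
  where
  go : ∀ {f f′ Z xs ys} → f ≤′ f′ → evalVec f Z gs xs ≡ just ys → evalVec f′ Z gs xs ≡ just ys
  go ≤′-refl        e = e
  go (≤′-step f≤f′) e = evalVec-mono-suc gs (go f≤f′ e)

module _ {Z : SetN} where

  conv-≡ : ∀ {n} {c : Code n} {xs v w} → v ≡ w → Conv c Z xs v → Conv c Z xs w
  conv-≡ refl cv = cv

  zero-conv : ∀ {n} {xs : Vec ℕ n} → Conv zeroC Z xs 0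
  zero-conv = 1 , refl

  succ-conv : ∀ {x} → Conv succC Z (x ∷ []) (suc x)
  succ-conv = 1 , refl

  proj-conv : ∀ {n} {xs : Vec ℕ n} i → Conv (proj i) Z xs (lookup xs i)
  proj-conv i = 1 , refl

  oracle-conv : ∀ {x} → Conv oracle Z (x ∷ []) (bit (Z x))
  oracle-conv = 1 , refl

  evalVec-conv : ∀ {m n} {gs : Fin m → Code n} {xs} {ys : Vec ℕ m} →
                 (∀ i → Conv (gs i) Z xs (lookup ys i)) → Σ ℕ λ f → evalVec f Z gs xs ≡ just ys
  evalVec-conv {ys = []} _ = 0 , refl
  evalVec-conv {gs = gs} {xs} {y ∷ ys} args
    with args fz | evalVec-conv {gs = λ i → gs (fs i)} (λ i → args (fs i))
  ... | f₁ , e₁ | f₂ , e₂ = f₁ ⊔ f₂ , joined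
    where
    joined : evalVec (f₁ ⊔ f₂) Z gs xs ≡ just (y ∷ ys)
    joined rewrite eval-mono (m≤m⊔n f₁ f₂) e₁ | evalVec-mono {gs = λ i → gs (fs i)} (m≤n⊔m f₁ f₂) e₂ = refl

  comp-conv : ∀ {m n} {h : Code m} {gs : Fin m → Code n} {xs ys v} →
              (∀ i → Conv (gs i) Z xs (lookup ys i)) → Conv h Z ys v → Conv (comp h gs) Z xs v
  comp-conv {h = h} {gs} {xs} {ys} {v} args (f₂ , e₂) with evalVec-conv {gs = gs} args
  ... | f₁ , e₁ = suc (f₁ ⊔ f₂) , composed
    where
    composed : eval (suc (f₁ ⊔ f₂)) Z (comp h gs) xs ≡ just v
    composed rewrite evalVec-mono {gs = gs} (m≤m⊔n f₁ f₂) e₁ = eval-mono (m≤n⊔m f₁ f₂) e₂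

  prec-conv : ∀ {n} {g : Code n} {h : Code (suc (suc n))} {xs z} {s : ℕ → ℕ → ℕ} →
              Conv g Z xs z → (∀ i r → Conv h Z (i ∷ r ∷ xs) (s i r)) →
              ∀ k → Conv (prec g h) Z (k ∷ xs) (primRec s z k)
  prec-conv (f , e) step zero = suc f , e
  prec-conv {g = g} {h} {xs} {z} {s} base step (suc k)
    with prec-conv base step k | step k (primRec s z k)
  ... | f₁ , e₁ | f₂ , e₂ = suc (f₁ ⊔ f₂) , iterated
    where
    iterated : eval (suc (f₁ ⊔ f₂)) Z (prec g h) (suc k ∷ xs) ≡ just (primRec s z (suc k))
    iterated rewrite eval-mono {c = prec g h} (m≤m⊔n f₁ f₂) e₁ = eval-mono (m≤n⊔m f₁ f₂) e₂

ifZero : ℕ → ℕ → ℕ → ℕ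
ifZero zero    b c = b
ifZero (suc _) b c = c

addC : Code 2
addC = prec (proj fz) (comp succC λ _ → proj (fs fz))

predC : Code 1
predC = prec zeroC (proj fz)

monusC : Code 2
monusC = prec (proj fz) (comp predC λ _ → proj (fs fz))

triC : Code 1
triC = prec zeroC (comp addC λ { fz → proj (fs fz) ; (fs fz) → comp succC λ _ → proj fz })

ifZeroC : Code 3
ifZeroC = prec (proj fz) (proj (fs (fs (fs fz))))

module _ {Z : SetN} where

  add-conv : ∀ {x y} → Conv addC Z (x ∷ y ∷ []) (x + y)
  add-conv {x} {y} =
    conv-≡ (sum x) (prec-conv (proj-conv fz) (λ _ _ → comp-conv (λ { fz → proj-conv (fs fz) }) succ-conv) x)
    where
    sum : ∀ x → primRec (λ _ r → suc r) y x ≡ x + y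
    sum zero    = refl
    sum (suc x) = cong suc (sum x)

  pred-conv : ∀ {x} → Conv predC Z (x ∷ []) (pred x)
  pred-conv {x} = conv-≡ (predecessor x) (prec-conv zero-conv (λ _ _ → proj-conv fz) x)
    where
    predecessor : ∀ x → primRec (λ i _ → i) 0 x ≡ pred x
    predecessor zero    = refl
    predecessor (suc x) = refl

  -- the arguments come in reverse order: recursion runs on the subtrahend
  monus-conv : ∀ {x y} → Conv monusC Z (y ∷ x ∷ []) (x ∸ y)
  monus-conv {x} {y} =
    conv-≡ (difference y) (prec-conv (proj-conv fz) (λ _ _ → comp-conv (λ { fz → proj-conv (fs fz) }) pred-conv) y)
    where
    difference : ∀ y → primRec (λ _ r → pred r) x y ≡ x ∸ y
    difference zero    = refl
    difference (suc y) = trans (cong pred (difference y)) (pred[m∸n]≡m∸[1+n] x y)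

  tri-conv : ∀ {x} → Conv triC Z (x ∷ []) (tri x)
  tri-conv {x} =
    conv-≡ (triangle x)
      (prec-conv zero-conv
        (λ _ _ → comp-conv (λ { fz → proj-conv (fs fz) ; (fs fz) → comp-conv (λ { fz → proj-conv fz }) succ-conv })
                           add-conv)
        x)
    where
    triangle : ∀ x → primRec (λ i r → r + suc i) 0 x ≡ tri x
    triangle zero    = refl
    triangle (suc x) = cong (_+ suc x) (triangle x)

  ifZero-conv : ∀ {a b c} → Conv ifZeroC Z (a ∷ b ∷ c ∷ []) (ifZero a b c)
  ifZero-conv {a} {b} {c} =
    conv-≡ (cases a) (prec-conv (proj-conv fz) (λ _ _ → proj-conv (fs (fs (fs fz)))) a)
    where
    cases : ∀ a → primRec (λ _ _ → c) b a ≡ ifZero a b c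
    cases zero    = refl
    cases (suc a) = refl

data Exp (n : ℕ) : Set where
  `var    : Fin n → Exp n
  `zero   : Exp n
  `suc    : Exp n → Exp n
  _`+_    : Exp n → Exp n → Exp n
  _`∸_    : Exp n → Exp n → Exp n
  `tri    : Exp n → Exp n
  `ifZero : Exp n → Exp n → Exp n → Exp n
  `oracle : Exp n → Exp n
  `rec    : Exp n → Exp (suc (suc n)) → Exp n → Exp n

⟦_⟧ : ∀ {n} → Exp n → SetN → Vec ℕ n → ℕ
⟦ `var i ⟧        Z xs = lookup xs i
⟦ `zero ⟧         Z xs = 0
⟦ `suc a ⟧        Z xs = suc (⟦ a ⟧ Z xs)
⟦ a `+ b ⟧        Z xs = ⟦ a ⟧ Z xs + ⟦ b ⟧ Z xs
⟦ a `∸ b ⟧        Z xs = ⟦ a ⟧ Z xs ∸ ⟦ b ⟧ Z xs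
⟦ `tri a ⟧        Z xs = tri (⟦ a ⟧ Z xs)
⟦ `ifZero a b c ⟧ Z xs = ifZero (⟦ a ⟧ Z xs) (⟦ b ⟧ Z xs) (⟦ c ⟧ Z xs)
⟦ `oracle a ⟧     Z xs = bit (Z (⟦ a ⟧ Z xs))
⟦ `rec z s k ⟧    Z xs = primRec (λ i r → ⟦ s ⟧ Z (i ∷ r ∷ xs)) (⟦ z ⟧ Z xs) (⟦ k ⟧ Z xs)

compile : ∀ {n} → Exp n → Code n
compile (`var i)        = proj i
compile `zero           = zeroC
compile (`suc a)        = comp succC λ _ → compile a
compile (a `+ b)        = comp addC λ { fz → compile a ; (fs fz) → compile b }
compile (a `∸ b)        = comp monusC λ { fz → compile b ; (fs fz) → compile a }
compile (`tri a)        = comp triC λ _ → compile a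
compile (`ifZero a b c) = comp ifZeroC λ { fz → compile a ; (fs fz) → compile b ; (fs (fs fz)) → compile c }
compile (`oracle a)     = comp oracle λ _ → compile a
compile (`rec z s k)    = comp (prec (compile z) (compile s)) λ { fz → compile k ; (fs i) → proj i }

compile-conv : ∀ {n Z} (e : Exp n) {xs} → Conv (compile e) Z xs (⟦ e ⟧ Z xs)
compile-conv (`var i)        = proj-conv i
compile-conv `zero           = zero-conv
compile-conv (`suc a)        = comp-conv (λ { fz → compile-conv a }) succ-conv
compile-conv (a `+ b)        = comp-conv (λ { fz → compile-conv a ; (fs fz) → compile-conv b }) add-conv
compile-conv (a `∸ b)        = comp-conv (λ { fz → compile-conv b ; (fs fz) → compile-conv a }) monus-conv
compile-conv (`tri a)        = comp-conv (λ { fz → compile-conv a }) tri-conv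
compile-conv (`ifZero a b c) =
  comp-conv (λ { fz → compile-conv a ; (fs fz) → compile-conv b ; (fs (fs fz)) → compile-conv c }) ifZero-conv
compile-conv (`oracle a)     = comp-conv (λ { fz → compile-conv a }) oracle-conv
compile-conv {Z = Z} (`rec z s k) {xs} =
  comp-conv {ys = ⟦ k ⟧ Z xs ∷ xs} (λ { fz → compile-conv k ; (fs i) → proj-conv i })
            (prec-conv (compile-conv z) (λ _ _ → compile-conv s) (⟦ k ⟧ Z xs))

pair-suc-right : ∀ x y → pair x (suc y) ≡ suc (pair (suc x) y)
pair-suc-right x y rewrite +-suc x y = +-suc (tri (suc (x + y))) y

pair-zero-right : ∀ x → pair (suc x) 0 ≡ suc (pair 0 x)
pair-zero-right x rewrite +-identityʳ x | +-identityʳ (tri x + suc x) = +-suc (tri x) x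

unpair-pair : ∀ x y → unpair (pair x y) ≡ (x , y)
unpair-pair x y = along-diagonal (x + y) x y refl
  where
  along-diagonal : ∀ d x y → x + y ≡ d → unpair (pair x y) ≡ (x , y)
  along-diagonal d x (suc y) eq
    rewrite pair-suc-right x y | along-diagonal d (suc x) y (trans (sym (+-suc x y)) eq) = refl
  along-diagonal d       zero    zero eq = refl
  along-diagonal zero    (suc x) zero ()
  along-diagonal (suc d) (suc x) zero eq
    rewrite pair-zero-right x | +-identityʳ x | along-diagonal d zero x (suc-injective eq) = refl

-- If code c is the last one on diagonal d, i.e. c ∸ tri d = d, then c + 1 starts diagonal d + 1.
diagonalStep : ℕ → ℕ → ℕ
diagonalStep c d = ifZero (d ∸ (c ∸ tri d)) (suc d) d

diagonal : ℕ → ℕ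
diagonal = primRec diagonalStep 0

unpairʳ : ℕ → ℕ
unpairʳ c = c ∸ tri (diagonal c)

unpairˡ : ℕ → ℕ
unpairˡ c = diagonal c ∸ unpairʳ c

OnDiagonal : ℕ → ℕ → ℕ → Set
OnDiagonal c d y = c ≡ tri d + y × y ≤ d × unpair c ≡ (d ∸ y , y)

onDiagonal-suc : ∀ {c d y} → OnDiagonal c d y → Σ ℕ (OnDiagonal (suc c) (diagonalStep c d))
onDiagonal-suc {d = d} {y} (refl , y≤d , unpair≡) with m≤n⇒m<n∨m≡n y≤d
... | inj₂ refl rewrite m+n∸m≡n (tri y) y | n∸n≡0 y =
  0 , sym (trans (+-identityʳ _) (+-suc (tri y) y)) , z≤n , cong nextPair unpair≡
onDiagonal-suc {d = suc d} {y} (refl , _ , unpair≡) | inj₁ (s≤s y≤d)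
  rewrite m+n∸m≡n (tri (suc d)) y | +-∸-assoc 1 y≤d =
  suc y , sym (+-suc (tri (suc d)) y) , s≤s y≤d , cong nextPair unpair≡

onDiagonal : ∀ c → Σ ℕ (OnDiagonal c (diagonal c))
onDiagonal zero    = 0 , refl , z≤n , refl
onDiagonal (suc c) with onDiagonal c
... | _ , on = onDiagonal-suc on

unpair-diagonal : ∀ c → unpair c ≡ (unpairˡ c , unpairʳ c)
unpair-diagonal c with onDiagonal c
... | y , c≡ , _ , unpair≡ = subst (λ u → unpair c ≡ (diagonal c ∸ u , u)) (sym unpairʳ≡) unpair≡
  where
  unpairʳ≡ : unpairʳ c ≡ y
  unpairʳ≡ = trans (cong (_∸ tri (diagonal c)) c≡) (m+n∸m≡n (tri (diagonal c)) y)

unpairˡ-pair : ∀ x y → unpairˡ (pair x y) ≡ x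
unpairˡ-pair x y = cong proj₁ (trans (sym (unpair-diagonal (pair x y))) (unpair-pair x y))

unpairʳ-pair : ∀ x y → unpairʳ (pair x y) ≡ y
unpairʳ-pair x y = cong proj₂ (trans (sym (unpair-diagonal (pair x y))) (unpair-pair x y))

`# : ∀ {n} → ℕ → Exp n
`# zero    = `zero
`# (suc k) = `suc (`# k)

`pair : ∀ {n} → Exp n → Exp n → Exp n
`pair a b = `tri (a `+ b) `+ b

-- ⟦ `diagonal a ⟧ Z xs reduces to diagonal (⟦ a ⟧ Z xs), so unpairˡ-pair and unpairʳ-pair rewrite
-- the values of `unpairˡ and `unpairʳ.
`diagonal : ∀ {n} → Exp n → Exp n
`diagonal = `rec `zero (`ifZero (d `∸ (c `∸ `tri d)) (`suc d) d)
  where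
  c d : ∀ {n} → Exp (suc (suc n))
  c = `var fz
  d = `var (fs fz)

`unpairʳ `unpairˡ : ∀ {n} → Exp n → Exp n
`unpairʳ a = a `∸ `tri (`diagonal a)
`unpairˡ a = `diagonal a `∸ `unpairʳ a

`query : ∀ {n} → Exp n → Exp n → Exp n
`query i c = `oracle (`pair i c)

-- Booleans are coded by numbers through toBool.
_`≤_ _`∧_ _`∨_ : ∀ {n} → Exp n → Exp n → Exp n
a `≤ b = `ifZero (a `∸ b) (`# 1) `zero
a `∧ b = `ifZero a `zero b
a `∨ b = a `+ b

toBool-bit : ∀ b → toBool (bit b) ≡ b
toBool-bit true  = refl
toBool-bit false = refl

toBool-≤ : ∀ x y → toBool (ifZero (x ∸ y) 1 0) ≡ (x ≤ᵇ y)
toBool-≤ zero    zero    = refl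
toBool-≤ zero    (suc y) = refl
toBool-≤ (suc x) zero    = refl
toBool-≤ (suc x) (suc y) = trans (toBool-≤ x y) (≤ᵇ-suc x)
  where
  ≤ᵇ-suc : ∀ x → (x ≤ᵇ y) ≡ (x <ᵇ suc y)
  ≤ᵇ-suc zero    = refl
  ≤ᵇ-suc (suc x) = refl

toBool-∧ : ∀ a b → toBool (ifZero a 0 b) ≡ toBool a ∧ toBool b
toBool-∧ zero    b = refl
toBool-∧ (suc a) b = refl

toBool-∨ : ∀ a b → toBool (a + b) ≡ toBool a ∨ toBool b
toBool-∨ zero    b = refl
toBool-∨ (suc a) b = refl

join-pair : ∀ (X : ℕ → SetN) {n i} k → i < n → join X n (pair i k) ≡ X i k
join-pair X {n} {i} k i<n rewrite unpair-pair i k | Equivalence.to T-≡ (<⇒<ᵇ i<n) = refl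

query-join : ∀ (X : ℕ → SetN) {n i} k → i < n → toBool (bit (join X n (pair i k))) ≡ X i k
query-join X k i<n = trans (toBool-bit _) (join-pair X k i<n)

module Strategy (P Q : Problem) (e : Exp 2) (X : ℕ → SetN) where
  open Game P Q (compile e) X public

  move : ℕ → SetN
  move n c = toBool (⟦ e ⟧ (join X n) (n ∷ suc c ∷ []))

  flag-conv : ∀ n → Flag n (⟦ e ⟧ (join X n) (n ∷ 0 ∷ []))
  flag-conv n = compile-conv e

  plays-move : ∀ n → Plays n (move n)
  plays-move n k = _ , compile-conv e , refl

  plays-≗ : ∀ {n Y Y′} → Plays n Y → (∀ c → Y c ≡ Y′ c) → Plays n Y′
  plays-≗ plays Y≗Y′ k with plays k
  ... | v , conv , v≡ = v , conv , trans v≡ (Y≗Y′ k)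

domᵇ : SetN → ℕ → Bool
domᵇ X x = X (pair 0 x)

leᵇ : SetN → ℕ → ℕ → Bool
leᵇ X x y = X (pair 1 (pair x y))

record Codes (Y : SetN) (dom : ℕ → Bool) (le : ℕ → ℕ → Bool) : Set where
  field
    dom-code : ∀ x → Y (pair 0 x) ≡ dom x
    le-code  : ∀ x y → Y (pair 1 (pair x y)) ≡ le x y

  dom⁺ : ∀ x → dom x ≡ true → Dom Y x
  dom⁺ x = trans (dom-code x)

  dom⁻ : ∀ x → Dom Y x → dom x ≡ true
  dom⁻ x = trans (sym (dom-code x))

  le⁺ : ∀ x y → le x y ≡ true → Le Y x y
  le⁺ x y = trans (le-code x y)

  le⁻ : ∀ x y → Le Y x y → le x y ≡ true
  le⁻ x y = trans (sym (le-code x y))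

  nle⁻ : ∀ x y → NLe Y x y → le x y ≡ false
  nle⁻ x y = trans (sym (le-code x y))

  infinite : InfiniteSet dom → InfiniteSet (domᵇ Y)
  infinite inf n with inf n
  ... | x , n≤x , x∈dom = x , n≤x , dom⁺ x x∈dom

nle⇒¬le : ∀ X x y → NLe X x y → ¬ Le X x y
nle⇒¬le X x y nle le with trans (sym le) nle
... | ()

¬le⇒nle : ∀ X x y → ¬ Le X x y → NLe X x y
¬le⇒nle X x y = ¬-not

module _ {X Y : SetN} (codes : Codes Y (domᵇ X) (leᵇ X)) where
  open Codes codes

  codes-isInfinitePoset : IsInfinitePoset X → IsInfinitePoset Y
  codes-isInfinitePoset ((reflexive , antisymmetric , transitive) , inf) =
    ( (λ x d → le⁺ x x (reflexive x (dom⁻ x d)))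
    , (λ x y dx dy l₁ l₂ → antisymmetric x y (dom⁻ x dx) (dom⁻ y dy) (le⁻ x y l₁) (le⁻ y x l₂))
    , (λ x y z dx dy dz l₁ l₂ →
         le⁺ x z (transitive x y z (dom⁻ x dx) (dom⁻ y dy) (dom⁻ z dz) (le⁻ x y l₁) (le⁻ y z l₂))))
    , infinite inf

  codes-CACSol : ∀ {S} → CACSol Y S → CACSol X S
  codes-CACSol (S⊆Y , inf , inj₁ chain) =
    (λ x x∈S → dom⁻ x (S⊆Y x x∈S)) , inf ,
    inj₁ (λ x y x∈S y∈S → Sum.map (le⁻ x y) (le⁻ y x) (chain x y x∈S y∈S))
  codes-CACSol (S⊆Y , inf , inj₂ antichain) =
    (λ x x∈S → dom⁻ x (S⊆Y x x∈S)) , inf ,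
    inj₂ (λ x y x∈S y∈S x≢y → Product.map (nle⁻ x y) (nle⁻ y x) (antichain x y x∈S y∈S x≢y))

∧-true⁻ : ∀ a b → a ∧ b ≡ true → a ≡ true × b ≡ true
∧-true⁻ true true _ = refl , refl

∨-true⁻ : ∀ a b → a ∨ b ≡ true → a ≡ true ⊎ b ≡ true
∨-true⁻ true  b    _ = inj₁ refl
∨-true⁻ false true _ = inj₂ refl

∨-true⁺ : ∀ a b → a ≡ true ⊎ b ≡ true → a ∨ b ≡ true
∨-true⁺ true  b _          = refl
∨-true⁺ false b (inj₂ b≡t) = b≡t

sortedᵇ : (ℕ → ℕ → Bool) → ℕ → ℕ → Bool
sortedᵇ s x y = (x ≤ᵇ y) ∧ s x y

sortedᵇ-true⁻ : ∀ s x y → sortedᵇ s x y ≡ true → x ≤ y × s x y ≡ true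
sortedᵇ-true⁻ s x y e = Product.map₁ (≤ᵇ⇒≤ x y ∘ Equivalence.from T-≡) (∧-true⁻ (x ≤ᵇ y) (s x y) e)

sortedᵇ-true⁺ : ∀ s x y → x ≤ y → s x y ≡ true → sortedᵇ s x y ≡ true
sortedᵇ-true⁺ s x y x≤y sxy rewrite Equivalence.to T-≡ (≤⇒≤ᵇ x≤y) = sxy

-- An ω-ordered poset is obtained by intersecting ≤ with any relation that is reflexive on the domain
-- and transitive along ≤-increasing triples; antisymmetry comes for free from ≤.
module Sorted {Y : SetN} {dom : ℕ → Bool} {s : ℕ → ℕ → Bool} (codes : Codes Y dom (sortedᵇ s)) where
  open Codes codes

  le⇒ : ∀ x y → Le Y x y → x ≤ y × s x y ≡ true
  le⇒ x y l = sortedᵇ-true⁻ s x y (le⁻ x y l)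

  le⇐ : ∀ x y → x ≤ y → s x y ≡ true → Le Y x y
  le⇐ x y x≤y sxy = le⁺ x y (sortedᵇ-true⁺ s x y x≤y sxy)

  sorted-instance :
    (∀ x → dom x ≡ true → s x x ≡ true) →
    (∀ {x y z} → dom x ≡ true → dom y ≡ true → dom z ≡ true → x ≤ y → y ≤ z →
                 s x y ≡ true → s y z ≡ true → s x z ≡ true) →
    InfiniteSet dom → IsInfinitePoset Y × OmegaOrdered Y
  sorted-instance reflexive transitive inf =
    ( ( (λ x d → le⇐ x x ≤-refl (reflexive x (dom⁻ x d)))
      , (λ x y _ _ l₁ l₂ → ≤-antisym (proj₁ (le⇒ x y l₁)) (proj₁ (le⇒ y x l₂)))
      , (λ x y z dx dy dz l₁ l₂ →
           let x≤y , sxy = le⇒ x y l₁ ; y≤z , syz = le⇒ y z l₂ in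
           le⇐ x z (≤-trans x≤y y≤z) (transitive (dom⁻ x dx) (dom⁻ y dy) (dom⁻ z dz) x≤y y≤z sxy syz)))
    , infinite inf )
    , (λ x y _ _ l → proj₁ (le⇒ x y l))

Comparable : SetN → ℕ → ℕ → Set
Comparable X x y = Le X x y ⊎ Le X y x

comparableᵇ : SetN → ℕ → ℕ → Bool
comparableᵇ X x y = leᵇ X x y ∨ leᵇ X y x

¬comparable⇒nle : ∀ X x y → ¬ Comparable X x y → NLe X x y × NLe X y x
¬comparable⇒nle X x y ¬c = ¬le⇒nle X x y (¬c ∘ inj₁) , ¬le⇒nle X y x (¬c ∘ inj₂)

Ascending : SetN → SetN → Set
Ascending X A = ∀ {a b} → A a ≡ true → A b ≡ true → a ≤ b → Le X a b

Descending : SetN → SetN → Set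
Descending X A = ∀ {a b} → A a ≡ true → A b ≡ true → a ≤ b → Comparable X a b → Le X b a

comparable-trans : ∀ {X A} → IsPoset X → SubsetDom X A → Ascending X A ⊎ Descending X A →
                   ∀ {a b c} → A a ≡ true → A b ≡ true → A c ≡ true → a ≤ b → b ≤ c →
                   Comparable X a b → Comparable X b c → Comparable X a c
comparable-trans _ _ (inj₁ ascending) a∈A _ c∈A a≤b b≤c _ _ = inj₁ (ascending a∈A c∈A (≤-trans a≤b b≤c))
comparable-trans (_ , _ , transitive) A⊆X (inj₂ descending) {a} {b} {c} a∈A b∈A c∈A a≤b b≤c ab bc =
  inj₂ (transitive c b a (A⊆X c c∈A) (A⊆X b b∈A) (A⊆X a a∈A)
                   (descending b∈A c∈A b≤c bc) (descending a∈A b∈A a≤b ab))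

module Refinement {X Y : SetN} (codes : Codes Y (domᵇ X) (sortedᵇ (leᵇ X))) where
  open Codes codes
  open Sorted codes

  refinement-instance : IsInfinitePoset X → IsInfinitePoset Y × OmegaOrdered Y
  refinement-instance ((reflexive , _ , transitive) , inf) =
    sorted-instance reflexive (λ {x} {y} {z} dx dy dz _ _ → transitive x y z dx dy dz) inf

  refinement-solution : ∀ {A} → IsPoset X → CACSol Y A → Ascending X A ⊎ Descending X A
  refinement-solution {A} (reflexive , _ , _) (A⊆Y , _ , inj₁ chain) = inj₁ ascending
    where
    ascending : Ascending X A
    ascending {a} {b} a∈A b∈A a≤b with chain a b a∈A b∈A
    ... | inj₁ ab = proj₂ (le⇒ a b ab)
    ... | inj₂ ba = subst (Le X a) (≤-antisym a≤b (proj₁ (le⇒ b a ba))) (reflexive a (dom⁻ a (A⊆Y a a∈A)))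
  refinement-solution {A} (reflexive , _ , _) (A⊆Y , _ , inj₂ antichain) = inj₂ descending
    where
    descending : Descending X A
    descending {a} {b} a∈A b∈A a≤b comparable with a ≟ b
    ... | yes refl = reflexive a (dom⁻ a (A⊆Y a a∈A))
    ... | no a≢b   = Sum.[ (λ ab → ⊥-elim (nle⇒¬le Y a b nab (le⇐ a b a≤b ab))) , id ] comparable
      where
      nab : NLe Y a b
      nab = proj₁ (antichain a b a∈A b∈A a≢b)

module SortedComparability {X A Y : SetN} (codes : Codes Y A (sortedᵇ (comparableᵇ X))) where
  open Codes codes
  open Sorted codes

  le⇒comparable : ∀ x y → Le Y x y → Comparable X x y
  le⇒comparable x y l = ∨-true⁻ (leᵇ X x y) (leᵇ X y x) (proj₂ (le⇒ x y l))

  sortedComparable-instance : IsPoset X → SubsetDom X A → InfiniteSet A → Ascending X A ⊎ Descending X A →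
                              IsInfinitePoset Y × OmegaOrdered Y
  sortedComparable-instance poset@(reflexive , _ , _) A⊆X inf shape =
    sorted-instance
      (λ x x∈A → ∨-true⁺ (leᵇ X x x) _ (inj₁ (reflexive x (A⊆X x x∈A))))
      (λ {x} {y} {z} x∈A y∈A z∈A x≤y y≤z sxy syz →
         ∨-true⁺ (leᵇ X x z) _ (comparable-trans {X} poset A⊆X shape x∈A y∈A z∈A x≤y y≤z
                                  (∨-true⁻ (leᵇ X x y) _ sxy) (∨-true⁻ (leᵇ X y z) _ syz)))
      inf

  incomparable : ∀ x y → NLe Y x y → x ≤ y → ¬ Comparable X x y
  incomparable x y nle x≤y c = nle⇒¬le Y x y nle (le⇐ x y x≤y (∨-true⁺ (leᵇ X x y) _ c))

  sortedComparable-solution : ∀ {B} → SubsetDom X A → CACSol Y B → CACSol X B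
  sortedComparable-solution A⊆X (B⊆Y , inf , chainOrAntichain) =
    (λ x x∈B → A⊆X x (dom⁻ x (B⊆Y x x∈B))) , inf , Sum.map chain antichain chainOrAntichain
    where
    chain : ∀ {B} → IsChain Y B → IsChain X B
    chain isChain x y x∈B y∈B with isChain x y x∈B y∈B
    ... | inj₁ xy = le⇒comparable x y xy
    ... | inj₂ yx = Sum.swap (le⇒comparable y x yx)
    antichain : ∀ {B} → IsAntichain Y B → IsAntichain X B
    antichain isAntichain x y x∈B y∈B x≢y with ≤-total x y | isAntichain x y x∈B y∈B x≢y
    ... | inj₁ x≤y | nxy , _ = ¬comparable⇒nle X x y (incomparable x y nxy x≤y)
    ... | inj₂ y≤x | _ , nyx = Product.swap (¬comparable⇒nle X y x (incomparable y x nyx y≤x))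

-- Move n has flag n ∸ 1 and copies X (n ∸ 1).
copy : Exp 2
copy = `ifZero k (n `∸ `# 1) (`query (n `∸ `# 1) (k `∸ `# 1))
  where
  n k : Exp 2
  n = `var fz
  k = `var (fs fz)

copy-wins : WinningStrategy ωCAC CAC (compile copy)
copy-wins X (instance₀ , _) legal =
  2 , s≤s z≤n , earlier , X 1 , flag-conv 2 , plays-≗ (plays-move 2) (λ c → query-join X c (n<1+n 1)) , solution
  where
  open Strategy ωCAC CAC copy X
  codes : Codes (move 1) (domᵇ (X 0)) (leᵇ (X 0))
  codes = record { dom-code = λ _ → query-join X _ z<s ; le-code = λ _ _ → query-join X _ z<s }
  continues₁ : Continues 1 (move 1)
  continues₁ = flag-conv 1 , plays-move 1 , codes-isInfinitePoset {X 0} codes instance₀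
  earlier : ∀ j → 1 ≤ j → j < 2 → Σ SetN (Continues j)
  earlier 1 _ _ = move 1 , continues₁
  earlier (suc (suc _)) _ (s≤s (s≤s ()))
  solution : CACSol (X 0) (X 1)
  solution = codes-CACSol {X 0} codes (legal 1 ≤-refl (λ { _ (s≤s z≤n) (s≤s ()) }) (move 1) continues₁)

`refinement : ∀ {n} → Exp n → Exp n
`refinement {n} c =
  `ifZero (`unpairˡ c) (`query `zero c) ((`unpairˡ p `≤ `unpairʳ p) `∧ `query `zero c)
  where
  p : Exp n
  p = `unpairʳ c

`sortedComparability : ∀ {n} → Exp n → Exp n
`sortedComparability {n} c =
  `ifZero (`unpairˡ c) (`query (`# 1) (`unpairʳ c))
    ((`unpairˡ p `≤ `unpairʳ p) `∧
     (`query `zero c `∨ `query `zero (`pair (`# 1) (`pair (`unpairʳ p) (`unpairˡ p)))))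
  where
  p : Exp n
  p = `unpairʳ c

-- Flags are 0 at moves 1 and 2 and 1 at move 3; the moves are the refinement of X 0, the sorted
-- comparability order on X 1, and the solution X 2.
refine : Exp 2
refine = `ifZero k (`ifZero (n `∸ `# 2) `zero (`# 1))
           (`ifZero (n `∸ `# 1) (`refinement c)
           (`ifZero (n `∸ `# 2) (`sortedComparability c) (`query (`# 2) c)))
  where
  n k c : Exp 2
  n = `var fz
  k = `var (fs fz)
  c = k `∸ `# 1

module RefineMoves (X : ℕ → SetN) where
  open Strategy CAC ωCAC refine X using (move)

  move₁-codes : Codes (move 1) (domᵇ (X 0)) (sortedᵇ (leᵇ (X 0)))
  Codes.dom-code move₁-codes x rewrite unpairˡ-pair 0 x = query-join X _ z<s
  Codes.le-code  move₁-codes x y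
    rewrite unpairˡ-pair 1 (pair x y) | unpairʳ-pair 1 (pair x y) | unpairˡ-pair x y | unpairʳ-pair x y =
    trans (toBool-∧ (ifZero (x ∸ y) 1 0) (bit (join X 1 (pair 0 (pair 1 (pair x y))))))
          (cong₂ _∧_ (toBool-≤ x y) (query-join X _ z<s))

  move₂-codes : Codes (move 2) (X 1) (sortedᵇ (comparableᵇ (X 0)))
  Codes.dom-code move₂-codes x rewrite unpairˡ-pair 0 x | unpairʳ-pair 0 x = query-join X _ (n<1+n 1)
  Codes.le-code  move₂-codes x y
    rewrite unpairˡ-pair 1 (pair x y) | unpairʳ-pair 1 (pair x y) | unpairˡ-pair x y | unpairʳ-pair x y =
    trans (toBool-∧ (ifZero (x ∸ y) 1 0) (query x y + query y x))
          (cong₂ _∧_ (toBool-≤ x y)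
                     (trans (toBool-∨ (query x y) (query y x))
                            (cong₂ _∨_ (query-join X _ z<s) (query-join X _ z<s))))
    where
    query : ℕ → ℕ → ℕ
    query a b = bit (join X 2 (pair 0 (pair 1 (pair a b))))

  move₃≗ : ∀ c → move 3 c ≡ X 2 c
  move₃≗ c = query-join X c (n<1+n 2)

refine-wins : WinningStrategy CAC ωCAC (compile refine)
refine-wins X instance₀@(poset₀ , _) legal =
  3 , s≤s z≤n , earlier , X 2 , flag-conv 3 , plays-≗ (plays-move 3) move₃≗ , solution
  where
  open Strategy CAC ωCAC refine X
  open RefineMoves X
  open Refinement {X 0} move₁-codes using (refinement-instance; refinement-solution)
  open SortedComparability {X 0} {X 1} move₂-codes using (sortedComparable-instance; sortedComparable-solution)
  continues₁ : Continues 1 (move 1)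
  continues₁ = flag-conv 1 , plays-move 1 , refinement-instance instance₀
  A-solves : CACSol (move 1) (X 1)
  A-solves = legal 1 ≤-refl (λ { _ (s≤s z≤n) (s≤s ()) }) (move 1) continues₁
  A⊆X₀ : SubsetDom (X 0) (X 1)
  A⊆X₀ x x∈A = Codes.dom⁻ move₁-codes x (proj₁ A-solves x x∈A)
  continues₂ : Continues 2 (move 2)
  continues₂ = flag-conv 2 , plays-move 2 ,
    sortedComparable-instance poset₀ A⊆X₀ (proj₁ (proj₂ A-solves)) (refinement-solution poset₀ A-solves)
  earlier : ∀ j → 1 ≤ j → j < 3 → Σ SetN (Continues j)
  earlier 1 _ _ = move 1 , continues₁
  earlier 2 _ _ = move 2 , continues₂
  earlier (suc (suc (suc _))) _ (s≤s (s≤s (s≤s ())))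
  B-solves : CACSol (move 2) (X 2)
  B-solves =
    legal 2 (s≤s z≤n) (λ { 1 _ _ → proj₁ continues₁ ; (suc (suc _)) _ (s≤s (s≤s ())) }) (move 2) continues₂
  solution : CACSol (X 0) (X 2)
  solution = sortedComparable-solution A⊆X₀ B-solves

theorem4 : (CAC ≤gW ωCAC) × (ωCAC ≤gW CAC)
theorem4 = (compile refine , refine-wins) , (compile copy , copy-wins)
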